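{- Let $N,\Delta$ be positive integers and $w=(\Delta^0,\Delta^1,\dots,\Delta^{N-1})\in\mathbb{Z}^N$. There is no vector $\bar{w}\in\mathbb{Z}^N$ with $\|\bar{w}\|_1<\Delta^{N-1}$ such that $w$ and $\bar{w}$ are equivalent on $\mathbb{Z}^N\cap[-\Delta,\Delta]^N$.
   Context: For a set $S\subseteq\mathbb{R}^N$, two vectors $w,\bar w\in\mathbb{R}^N$ are called equivalent on $S$ if for all $x,y\in S$: $w^Tx\geq w^Ty \iff \bar w^Tx\geq \bar w^Ty$. -}

module Defs where

open import Data.Nat as ℕ using (ℕ; suc)
open import Data.Integer as ℤ using (ℤ; +_; -_; _+_; _*_; _≥_; _≤_; ∣_∣)
open import Data.Fin using (Fin; zero; suc)
open import Data.Product using (_×_)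
open import Function.Bundles using (_⇔_)

sumℤ : ∀ {N} → (Fin N → ℤ) → ℤ
sumℤ {ℕ.zero} f = + 0
sumℤ {suc N} f = f zero + sumℤ (λ i → f (suc i))

sumℕ : ∀ {N} → (Fin N → ℕ) → ℕ
sumℕ {ℕ.zero} f = 0
sumℕ {suc N} f = f zero ℕ.+ sumℕ (λ i → f (suc i))

dot : ∀ {N} → (Fin N → ℤ) → (Fin N → ℤ) → ℤ
dot w x = sumℤ (λ i → w i * x i)

norm₁ : ∀ {N} → (Fin N → ℤ) → ℕ
norm₁ w = sumℕ (λ i → ∣ w i ∣)

InBox : ∀ {N} → ℕ → (Fin N → ℤ) → Set
InBox Δ x = ∀ i → (- (+ Δ) ≤ x i) × (x i ≤ + Δ)

EquivalentOn : ∀ {N} → ((Fin N → ℤ) → Set) → (Fin N → ℤ) → (Fin N → ℤ) → Set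
EquivalentOn S w w̄ = ∀ x y → S x → S y → (dot w x ≥ dot w y) ⇔ (dot w̄ x ≥ dot w̄ y)

powVec : (N Δ : ℕ) → Fin N → ℤ
powVec N Δ i = + (Δ ℕ.^ Data.Fin.toℕ i)

{-# OPTIONS --safe #-}
-- Comparing the scaled unit vectors Δ·e_i and e_(i+1), on which w takes the same value, forces
-- w̄_(i+1) = Δ w̄_i; comparing e_0 with 0 forces w̄_0 > 0. Hence |w̄_(N-1)| = Δ^(N-1) |w̄_0| ≥ Δ^(N-1).
module Submission where

open import Defs
open import Data.Nat as ℕ using (ℕ; zero; suc; z≤n; s≤s; _<_; _^_; _∸_; NonZero)
import Data.Nat.Properties as ℕP
open import Data.Integer as ℤ using (ℤ; +_; +<+; +≤+; ∣_∣)
import Data.Integer.Properties as ℤP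
open import Data.Fin using (Fin; zero; suc; inject₁; fromℕ; toℕ)
open import Data.Fin.Properties using (toℕ-inject₁)
open import Data.Product using (Σ; _×_; _,_)
open import Function using (_∘_)
open import Function.Bundles using (Equivalence)
open import Relation.Binary.PropositionalEquality
open import Relation.Nullary using (¬_)

infix 7 _·e_

_·e_ : ∀ {N} → ℤ → Fin N → Fin N → ℤ
(c ·e zero)  zero    = c
(c ·e zero)  (suc _) = + 0
(c ·e suc _) zero    = + 0
(c ·e suc j) (suc i) = (c ·e j) i

dot-zeroʳ : ∀ {N} (v : Fin N → ℤ) → dot v (λ _ → + 0) ≡ + 0
dot-zeroʳ {zero}  v = refl
dot-zeroʳ {suc N} v = cong₂ ℤ._+_ (ℤP.*-zeroʳ (v zero)) (dot-zeroʳ (v ∘ suc))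

dot-·e : ∀ {N} (v : Fin N → ℤ) c j → dot v (c ·e j) ≡ v j ℤ.* c
dot-·e v c zero = begin
  v zero ℤ.* c ℤ.+ dot (v ∘ suc) (λ _ → + 0) ≡⟨ cong (ℤ._+_ (v zero ℤ.* c)) (dot-zeroʳ (v ∘ suc)) ⟩
  v zero ℤ.* c ℤ.+ + 0                       ≡⟨ ℤP.+-identityʳ _ ⟩
  v zero ℤ.* c                               ∎
  where open ≡-Reasoning
dot-·e v c (suc j) = begin
  v zero ℤ.* + 0 ℤ.+ dot (v ∘ suc) (c ·e j) ≡⟨ cong₂ ℤ._+_ (ℤP.*-zeroʳ (v zero)) (dot-·e (v ∘ suc) c j) ⟩
  + 0 ℤ.+ v (suc j) ℤ.* c                   ≡⟨ ℤP.+-identityˡ _ ⟩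
  v (suc j) ℤ.* c                           ∎
  where open ≡-Reasoning

·e-inBox : ∀ {N Δ c} (j : Fin N) → c ℕ.≤ Δ → InBox Δ (+ c ·e j)
·e-inBox zero    c≤Δ zero    = ℤP.neg-≤-pos , +≤+ c≤Δ
·e-inBox zero    _   (suc i) = ℤP.neg-≤-pos , +≤+ z≤n
·e-inBox (suc j) _   zero    = ℤP.neg-≤-pos , +≤+ z≤n
·e-inBox (suc j) c≤Δ (suc i) = ·e-inBox j c≤Δ i

∣∣≤norm₁ : ∀ {N} (w : Fin N → ℤ) j → ∣ w j ∣ ℕ.≤ norm₁ w
∣∣≤norm₁ w zero    = ℕP.m≤m+n _ _
∣∣≤norm₁ w (suc j) = ℕP.≤-trans (∣∣≤norm₁ (w ∘ suc) j) (ℕP.m≤n+m _ _)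

module _ {N} {S : (Fin N → ℤ) → Set} (w w̄ : Fin N → ℤ) (equiv : EquivalentOn S w w̄) where

  equivalent-preserves-≡ : ∀ {x y} → S x → S y → dot w x ≡ dot w y → dot w̄ x ≡ dot w̄ y
  equivalent-preserves-≡ x∈S y∈S eq = ℤP.≤-antisym
    (Equivalence.to (equiv _ _ y∈S x∈S) (ℤP.≤-reflexive eq))
    (Equivalence.to (equiv _ _ x∈S y∈S) (ℤP.≤-reflexive (sym eq)))

  equivalent-preserves-< : ∀ {x y} → S x → S y → dot w x ℤ.< dot w y → dot w̄ x ℤ.< dot w̄ y
  equivalent-preserves-< x∈S y∈S lt =
    ℤP.≰⇒> (λ ge → ℤP.<⇒≱ lt (Equivalence.from (equiv _ _ x∈S y∈S) ge))

module _ {N Δ} (w w̄ : Fin N → ℤ) (equiv : EquivalentOn (InBox Δ) w w̄)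
         {a b} (a≤Δ : a ℕ.≤ Δ) (b≤Δ : b ℕ.≤ Δ) where

  ·e-preserves-≡ : ∀ i j → w i ℤ.* + a ≡ w j ℤ.* + b → w̄ i ℤ.* + a ≡ w̄ j ℤ.* + b
  ·e-preserves-≡ i j eq = begin
    w̄ i ℤ.* + a       ≡⟨ dot-·e w̄ (+ a) i ⟨
    dot w̄ (+ a ·e i)  ≡⟨ equivalent-preserves-≡ w w̄ equiv (·e-inBox i a≤Δ) (·e-inBox j b≤Δ) w-eq ⟩
    dot w̄ (+ b ·e j)  ≡⟨ dot-·e w̄ (+ b) j ⟩
    w̄ j ℤ.* + b       ∎
    where
    open ≡-Reasoning
    w-eq : dot w (+ a ·e i) ≡ dot w (+ b ·e j)
    w-eq = trans (dot-·e w (+ a) i) (trans eq (sym (dot-·e w (+ b) j)))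

  ·e-preserves-< : ∀ i j → w i ℤ.* + a ℤ.< w j ℤ.* + b → w̄ i ℤ.* + a ℤ.< w̄ j ℤ.* + b
  ·e-preserves-< i j lt = subst₂ ℤ._<_ (dot-·e w̄ (+ a) i) (dot-·e w̄ (+ b) j)
    (equivalent-preserves-< w w̄ equiv (·e-inBox i a≤Δ) (·e-inBox j b≤Δ)
      (subst₂ ℤ._<_ (sym (dot-·e w (+ a) i)) (sym (dot-·e w (+ b) j)) lt))

equivalent-preserves-pos : ∀ {N Δ} (w w̄ : Fin N → ℤ) .{{_ : NonZero Δ}} →
  EquivalentOn (InBox Δ) w w̄ → ∀ j → + 0 ℤ.< w j → + 0 ℤ.< w̄ j
equivalent-preserves-pos {Δ = Δ} w w̄ equiv j pos =
  subst₂ ℤ._<_ (ℤP.*-zeroʳ (w̄ j)) (ℤP.*-identityʳ (w̄ j))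
    (·e-preserves-< w w̄ equiv z≤n (ℕ.>-nonZero⁻¹ Δ) j j
      (subst₂ ℤ._<_ (sym (ℤP.*-zeroʳ (w j))) (sym (ℤP.*-identityʳ (w j))) pos))

Geometric : ∀ {n} → ℕ → (Fin (suc n) → ℤ) → Set
Geometric {n} r f = ∀ (m : Fin n) → f (suc m) ≡ + r ℤ.* f (inject₁ m)

powVec-geometric : ∀ n Δ → Geometric Δ (powVec (suc n) Δ)
powVec-geometric n Δ m = begin
  + (Δ ℕ.* Δ ^ toℕ m)             ≡⟨ ℤP.pos-* Δ _ ⟩
  + Δ ℤ.* + (Δ ^ toℕ m)           ≡⟨ cong (λ k → + Δ ℤ.* + (Δ ^ k)) (toℕ-inject₁ m) ⟨
  + Δ ℤ.* + (Δ ^ toℕ (inject₁ m)) ∎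
  where open ≡-Reasoning

geometric-last : ∀ n r (f : Fin (suc n) → ℤ) → Geometric r f → f (fromℕ n) ≡ + (r ^ n) ℤ.* f zero
geometric-last zero    r f geo = sym (ℤP.*-identityˡ (f zero))
geometric-last (suc n) r f geo = begin
  f (suc (fromℕ n))                 ≡⟨ geo (fromℕ n) ⟩
  + r ℤ.* f (inject₁ (fromℕ n))     ≡⟨ cong (+ r ℤ.*_) (geometric-last n r (f ∘ inject₁) (geo ∘ inject₁)) ⟩
  + r ℤ.* (+ (r ^ n) ℤ.* f zero)    ≡⟨ ℤP.*-assoc (+ r) _ _ ⟨
  + r ℤ.* + (r ^ n) ℤ.* f zero      ≡⟨ cong (ℤ._* f zero) (ℤP.pos-* r _) ⟨
  + (r ^ suc n) ℤ.* f zero          ∎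
  where open ≡-Reasoning

equivalent-preserves-geometric : ∀ {n Δ} (w w̄ : Fin (suc n) → ℤ) .{{_ : NonZero Δ}} →
  EquivalentOn (InBox Δ) w w̄ → Geometric Δ w → Geometric Δ w̄
equivalent-preserves-geometric {Δ = Δ} w w̄ equiv geo m = begin
  w̄ (suc m)                ≡⟨ ℤP.*-identityʳ _ ⟨
  w̄ (suc m) ℤ.* + 1        ≡⟨ ·e-preserves-≡ w w̄ equiv ℕP.≤-refl (ℕ.>-nonZero⁻¹ Δ) (inject₁ m) (suc m) w-eq ⟨
  w̄ (inject₁ m) ℤ.* + Δ    ≡⟨ ℤP.*-comm _ (+ Δ) ⟩
  + Δ ℤ.* w̄ (inject₁ m)    ∎
  where
  open ≡-Reasoning
  w-eq : w (inject₁ m) ℤ.* + Δ ≡ w (suc m) ℤ.* + 1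
  w-eq = trans (ℤP.*-comm _ (+ Δ)) (trans (sym (geo m)) (sym (ℤP.*-identityʳ _)))

theorem4 : (N Δ : ℕ) → .{{_ : NonZero N}} → .{{_ : NonZero Δ}} →
    ¬ (Σ (Fin N → ℤ) (λ w̄ → (norm₁ w̄ < Δ ^ (N ∸ 1)) × EquivalentOn (InBox Δ) (powVec N Δ) w̄))
theorem4 (suc n) Δ (w̄ , small , equiv) = ℕP.<⇒≱ small (begin
  Δ ^ n                    ≤⟨ ℕP.m≤m*n (Δ ^ n) ∣ w̄ zero ∣ {{ℤ.>-nonZero first-pos}} ⟩
  Δ ^ n ℕ.* ∣ w̄ zero ∣     ≡⟨ ℤP.abs-* (+ (Δ ^ n)) (w̄ zero) ⟨
  ∣ + (Δ ^ n) ℤ.* w̄ zero ∣ ≡⟨ cong ∣_∣ last-entry ⟨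
  ∣ w̄ (fromℕ n) ∣          ≤⟨ ∣∣≤norm₁ w̄ (fromℕ n) ⟩
  norm₁ w̄                  ∎)
  where
  open ℕP.≤-Reasoning
  first-pos : + 0 ℤ.< w̄ zero
  first-pos = equivalent-preserves-pos (powVec (suc n) Δ) w̄ equiv zero (+<+ (s≤s z≤n))
  last-entry : w̄ (fromℕ n) ≡ + (Δ ^ n) ℤ.* w̄ zero
  last-entry = geometric-last n Δ w̄
    (equivalent-preserves-geometric (powVec (suc n) Δ) w̄ equiv (powVec-geometric n Δ))
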